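{- The product $S_V\wr\!\wr B \in GR$ if and only if $B \in BGR$.
   Context: $S_V$ is the full symmetric group on $V$ and $B$ is a permutation group on $W$. $GR$ and $BGR$ denote the classes of permutation groups that are automorphism groups of colored graphs and colored hypergraphs (color functions on nonempty subsets of the vertex set), respectively. $A\wr\!\wr B$ is the wreath product in product action: permutations $\phi$ of $V^W$ with $(f\phi)(w) = (f(w\beta))\alpha_w$, $\beta\in B$, $\alpha_w\in A$ (right actions). -}

module Defs where

open import Level using (Level; _⊔_) renaming (suc to lsuc)
open import Data.Nat using (ℕ)
open import Data.Fin using (Fin)
open import Data.Fin.Subset using (Subset; Nonempty)
open import Data.Vec using (Vec; lookup; tabulate)
open import Data.Product using (Σ; ∃; _×_)
open import Function.Bundles using (_↔_; _⇔_; Inverse)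
open import Function.Construct.Identity using (↔-id)
open import Function.Construct.Composition using (_↔-∘_)
open import Function.Construct.Symmetry using (↔-sym)
open import Relation.Binary.PropositionalEquality using (_≡_; _≢_)

open Inverse

Perm : ∀ {a} → Set a → Set a
Perm X = X ↔ X

_≈ₚ_ : ∀ {a} {X : Set a} → Perm X → Perm X → Set a
σ ≈ₚ τ = ∀ x → to σ x ≡ to τ x

record IsPermGroup {a ℓ} {X : Set a} (G : Perm X → Set ℓ) : Set (a ⊔ ℓ) where
  field
    respects : ∀ {σ τ} → σ ≈ₚ τ → G σ → G τ
    id∈      : G (↔-id X)
    ∘∈       : ∀ {σ τ} → G σ → G τ → G (σ ↔-∘ τ)
    inv∈     : ∀ {σ} → G σ → G (↔-sym σ)

-- Colored graphs: a coloring of the 2-element subsets {x,y} (x ≠ y) of X,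
-- represented as a symmetric function on ordered pairs of distinct points.

record ColoredGraph {a} (X : Set a) : Set a where
  field
    colour    : X → X → ℕ
    symmetric : ∀ x y → colour x y ≡ colour y x

IsGraphAut : ∀ {a} {X : Set a} → ColoredGraph X → Perm X → Set a
IsGraphAut {X = X} Γ σ =
  ∀ (x y : X) → x ≢ y → ColoredGraph.colour Γ (to σ x) (to σ y) ≡ ColoredGraph.colour Γ x y

InGR : ∀ {a ℓ} {X : Set a} → (Perm X → Set ℓ) → Set (a ⊔ ℓ)
InGR {X = X} G = Σ (ColoredGraph X) λ Γ → ∀ σ → G σ ⇔ IsGraphAut Γ σ

image : ∀ {m} → Perm (Fin m) → Subset m → Subset m
image σ S = tabulate (λ x → lookup S (from σ x))

IsHyperAut : ∀ {m} → (Subset m → ℕ) → Perm (Fin m) → Set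
IsHyperAut {m} c σ = ∀ (S : Subset m) → Nonempty S → c (image σ S) ≡ c S

-- B ∈ BGR : B is exactly the automorphism group of some colored hypergraph
-- (the color of the empty set is irrelevant).
InBGR : ∀ {m ℓ} → (Perm (Fin m) → Set ℓ) → Set ℓ
InBGR {m} B = Σ (Subset m → ℕ) λ c → ∀ σ → B σ ⇔ IsHyperAut c σ

-- Wreath product in product action S_V ≀≀ B, V = Fin n, W = Fin m,
-- acting on V^W = Vec (Fin n) m:
--   (f φ)(w) = (f (w β)) α_w,  β ∈ B, α_w ∈ S_V arbitrary.

WreathSym : ∀ {ℓ} (n m : ℕ) → (Perm (Fin m) → Set ℓ) → Perm (Vec (Fin n) m) → Set ℓ
WreathSym n m B φ =
  Σ (Perm (Fin m)) λ β → B β ×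
    ∃ λ (α : Fin m → Perm (Fin n)) →
      ∀ (f : Vec (Fin n) m) → to φ f ≡ tabulate (λ w → to (α w) (lookup f (to β w)))

-- Two points of V^W are adjacent in the Hamming graph when they differ in exactly one
-- coordinate. Maps f ↦ (w ↦ α_w (f (β w))) preserve adjacency and move disagreement sets
-- by β. Conversely, for |V| ≥ 2 every automorphism φ of the Hamming graph has this form:
-- triangles and squares show that φ sends every edge in direction u to an edge in one fixed
-- direction d u, so d is a bijection and coordinate d u of φ f depends only on f u.
-- If B is the automorphism group of the hypergraph colouring c, colour {x, y} by c of the
-- disagreement set together with a bit recording adjacency: the automorphisms of this graph
-- are Hamming automorphisms, and the colours force their β into B. If S_V ≀≀ B is the
-- automorphism group of a graph colouring, the colour of a pair only depends on its
-- disagreement set S, and c(S) := colour {0, 1_S} has automorphism group exactly B.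
module Submission where

open import Defs
open import Level using (Level)
open import Data.Bool using (Bool; true; false; not)
open import Data.Empty using (⊥-elim)
open import Data.Fin using (Fin; zero; suc)
open import Data.Fin.Permutation using (transpose; _∘ₚ_)
open import Data.Fin.Properties using (_≟_; all?; any?; 0≢1+n)
open import Data.Fin.Subset using (Subset; Nonempty)
open import Data.Nat using (ℕ; suc; _+_; _≤_; s≤s; _*_)
open import Data.Nat.Properties using (even≢odd; *-cancelˡ-≡; suc-injective)
open import Data.Product using (Σ; ∃; _×_; _,_; proj₁; proj₂; map₂)
open import Data.Vec using (Vec; []; _∷_; lookup; tabulate; _[_]≔_)
open import Data.Vec.Properties
  using (lookup∘tabulate; tabulate-cong; lookup∘update; lookup∘update′; []≔-lookup;
         []≔-idempotent; []≔-commutes; lookup⇒[]=; []=⇒lookup; ≡-dec)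
open import Data.Vec.Relation.Binary.Pointwise.Extensional using (ext; Pointwise-≡⇒≡)
open import Function using (_∘_; const)
open import Function.Bundles using (Inverse; Injection; Equivalence; _⇔_; mk⇔; mk↔ₛ′)
open import Function.Construct.Identity using (↔-id)
open import Function.Construct.Symmetry using (↔-sym; ⇔-sym)
open import Function.Definitions using (Injective)
open import Function.Properties.Inverse using (↔⇒↣)
open import Relation.Nullary using (Dec; yes; no; does; ¬_; ¬?)
open import Relation.Nullary.Decidable
  using (map′; does-⇔; dec-true; dec-false; decidable-stable; _×-dec_; _→-dec_)
open import Relation.Binary.PropositionalEquality
  using (_≡_; _≢_; refl; sym; trans; cong; cong₂; subst; subst₂; module ≡-Reasoning)

open Inverse
open ≡-Reasoning

private
  variable
    ℓ : Level
    A : Set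
    n m : ℕ

perm-injective : {X : Set ℓ} (σ : Perm X) → Injective _≡_ _≡_ (to σ)
perm-injective σ = Injection.injective (↔⇒↣ σ)

lookup-ext : {x y : Vec A m} → (∀ i → lookup x i ≡ lookup y i) → x ≡ y
lookup-ext x≗y = Pointwise-≡⇒≡ (ext x≗y)

does-≡⇒⇔ : {P Q : Set} (p? : Dec P) (q? : Dec Q) → does p? ≡ does q? → P ⇔ Q
does-≡⇒⇔ (yes p) (yes q) _ = mk⇔ (const q) (const p)
does-≡⇒⇔ (no ¬p) (no ¬q) _ = mk⇔ (⊥-elim ∘ ¬p) (⊥-elim ∘ ¬q)
does-≡⇒⇔ (yes _) (no _)  ()
does-≡⇒⇔ (no _)  (yes _) ()

tag : Bool → ℕ → ℕ
tag false c = 2 * c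
tag true  c = suc (2 * c)

tag-injective : ∀ {b b′ c c′} → tag b c ≡ tag b′ c′ → b ≡ b′ × c ≡ c′
tag-injective {false} {false} {c} {c′} e = refl , *-cancelˡ-≡ c c′ 2 e
tag-injective {true}  {true}  {c} {c′} e = refl , *-cancelˡ-≡ c c′ 2 (suc-injective e)
tag-injective {false} {true}  {c} {c′} e = ⊥-elim (even≢odd c c′ e)
tag-injective {true}  {false} {c} {c′} e = ⊥-elim (even≢odd c′ c (sym e))

-- Permutations of Fin n

transpose-sends : (i j : Fin n) → to (transpose i j) i ≡ j
transpose-sends i j rewrite dec-true (i ≟ i) refl = refl

transpose-fixes : {i j k : Fin n} → k ≢ i → k ≢ j → to (transpose i j) k ≡ k
transpose-fixes {i = i} {j} {k} k≢i k≢j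
  rewrite dec-false (k ≟ i) k≢i | dec-false (k ≟ j) k≢j = refl

pair-transitive : {a b p q : Fin n} → a ≢ b → p ≢ q →
  Σ (Perm (Fin n)) λ π → to π a ≡ p × to π b ≡ q
pair-transitive {a = a} {b} {p} {q} a≢b p≢q =
  transpose a p ∘ₚ transpose b′ q , sends-a , transpose-sends b′ q
  where
  b′ : Fin _
  b′ = to (transpose a p) b
  p≢b′ : p ≢ b′
  p≢b′ p≡b′ = a≢b (perm-injective (transpose a p) (trans (transpose-sends a p) p≡b′))
  sends-a : to (transpose b′ q) (to (transpose a p) a) ≡ p
  sends-a = trans (cong (to (transpose b′ q)) (transpose-sends a p)) (transpose-fixes p≢b′ p≢q)

bit : Bool → Fin (2 + n)
bit false = zero
bit true  = suc zero

other : Fin (2 + n) → Fin (2 + n)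
other zero    = suc zero
other (suc _) = zero

other-≢ : (v : Fin (2 + n)) → other v ≢ v
other-≢ zero    ()
other-≢ (suc _) ()

pair-permutation : (p q : Fin (2 + n)) →
  Σ (Perm (Fin (2 + n))) λ π → to π zero ≡ p × to π (bit (not (does (p ≟ q)))) ≡ q
pair-permutation p q with p ≟ q
... | yes refl = transpose zero p , transpose-sends zero p , transpose-sends zero p
... | no p≢q   = pair-transitive (λ ()) p≢q

-- The Hamming graph on Vec A m

record Adj (a : Fin m) (x y : Vec A m) : Set where
  constructor mkAdj
  field
    differs : lookup x a ≢ lookup y a
    agrees  : ∀ i → i ≢ a → lookup x i ≡ lookup y i

open Adj

Adjacent : Vec A m → Vec A m → Set
Adjacent x y = ∃ λ a → Adj a x y

Apart : Vec A m → Vec A m → Set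
Apart x y = x ≢ y × ¬ Adjacent x y

PreservesAdjacency : Perm (Vec A m) → Set
PreservesAdjacency φ = ∀ x y → Adjacent x y ⇔ Adjacent (to φ x) (to φ y)

adj-sym : {a : Fin m} {x y : Vec A m} → Adj a x y → Adj a y x
adj-sym xy = mkAdj (differs xy ∘ sym) (λ i i≢a → sym (agrees xy i i≢a))

adjacent-sym : {x y : Vec A m} → Adjacent x y ⇔ Adjacent y x
adjacent-sym = mk⇔ (map₂ adj-sym) (map₂ adj-sym)

adjacent-irrefl : {x : Vec A m} → ¬ Adjacent x x
adjacent-irrefl (_ , xx) = differs xx refl

adj-unique : {a b : Fin m} {x y : Vec A m} → Adj a x y → Adj b x y → a ≡ b
adj-unique {a = a} {b} xy xy′ =
  decidable-stable (a ≟ b) λ a≢b → differs xy (agrees xy′ a a≢b)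

agree-off⇒adj : {a : Fin m} {x y : Vec A m} →
  (∀ i → i ≢ a → lookup x i ≡ lookup y i) → x ≢ y → Adj a x y
agree-off⇒adj {a = a} {x} {y} agree x≢y =
  mkAdj (λ xₐ≡yₐ → x≢y (lookup-ext (everywhere xₐ≡yₐ))) agree
  where
  everywhere : lookup x a ≡ lookup y a → ∀ i → lookup x i ≡ lookup y i
  everywhere xₐ≡yₐ i with i ≟ a
  ... | yes refl = xₐ≡yₐ
  ... | no i≢a   = agree i i≢a

adj⇒update : {a : Fin m} {x y : Vec A m} → Adj a x y → x [ a ]≔ lookup y a ≡ y
adj⇒update {a = a} {x} {y} xy = lookup-ext componentwise
  where
  componentwise : ∀ i → lookup (x [ a ]≔ lookup y a) i ≡ lookup y i
  componentwise i with i ≟ a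
  ... | yes refl = lookup∘update i x (lookup y i)
  ... | no i≢a   = trans (lookup∘update′ i≢a x _) (agrees xy i i≢a)

update-adj : (x : Vec A m) (u : Fin m) {v : A} → v ≢ lookup x u → Adj u x (x [ u ]≔ v)
update-adj x u {v} v≢xᵤ =
  mkAdj (λ e → v≢xᵤ (sym (trans e (lookup∘update u x v))))
        (λ i i≢u → sym (lookup∘update′ i≢u x v))

two-differences⇒apart : {u w : Fin m} {x y : Vec A m} → u ≢ w →
  lookup x u ≢ lookup y u → lookup x w ≢ lookup y w → Apart x y
two-differences⇒apart {u = u} {w} u≢w xᵤ≢yᵤ x_w≢y_w =
  (λ x≡y → xᵤ≢yᵤ (cong (λ z → lookup z u) x≡y)) , ¬adjacent
  where
  ¬adjacent : ¬ Adjacent _ _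
  ¬adjacent (e , xy) with u ≟ e | w ≟ e
  ... | no u≢e   | _        = xᵤ≢yᵤ (agrees xy u u≢e)
  ... | yes _    | no w≢e   = x_w≢y_w (agrees xy w w≢e)
  ... | yes refl | yes refl = u≢w refl

triangle-direction : {a b : Fin m} {x y z : Vec A m} →
  Adj a x y → Adj b x z → Adjacent y z → a ≡ b
triangle-direction {a = a} {b} xy xz yz = decidable-stable (a ≟ b) λ a≢b →
  proj₂ (two-differences⇒apart a≢b
          (λ e → differs xy (trans (agrees xz a a≢b) (sym e)))
          (λ e → differs xz (trans (agrees xy b (a≢b ∘ sym)) e)))
        yz

square-direction : {a b a′ b′ : Fin m} {x y₁ y₂ z : Vec A m} →
  Adj a x y₁ → Adj b x y₂ → Adj a′ y₂ z → Adj b′ y₁ z →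
  Apart y₁ y₂ → Apart x z → a′ ≡ a
square-direction {a = a} {b} {a′} {b′} xy₁ xy₂ y₂z y₁z (y₁≢y₂ , y₁≁y₂) (x≢z , x≁z) =
  decidable-stable (a′ ≟ a) λ a′≢a → differs y₂z
    (trans (sym (agrees xy₂ a′ a′≢b))
      (trans (agrees xy₁ a′ a′≢a) (agrees y₁z a′ (λ a′≡b′ → a′≢b (trans a′≡b′ b′≡b)))))
  where
  a≢b : a ≢ b
  a≢b refl = y₁≁y₂ (a , agree-off⇒adj
    (λ i i≢a → trans (sym (agrees xy₁ i i≢a)) (agrees xy₂ i i≢a)) y₁≢y₂)
  a′≢b : a′ ≢ b
  a′≢b refl = x≁z (a′ , agree-off⇒adj
    (λ i i≢a′ → trans (agrees xy₂ i i≢a′) (agrees y₂z i i≢a′)) x≢z)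
  b′≡b : b′ ≡ b
  b′≡b = decidable-stable (b′ ≟ b) λ b′≢b → differs xy₂
    (trans (agrees xy₁ b (a≢b ∘ sym))
      (trans (agrees y₁z b (b′≢b ∘ sym)) (sym (agrees y₂z b (a′≢b ∘ sym)))))

adj? : (a : Fin m) (x y : Vec (Fin n) m) → Dec (Adj a x y)
adj? a x y = map′ (λ (d , g) → mkAdj d g) (λ xy → differs xy , agrees xy)
  (¬? (lookup x a ≟ lookup y a) ×-dec all? (λ i → ¬? (i ≟ a) →-dec lookup x i ≟ lookup y i))

adjacent? : (x y : Vec (Fin n) m) → Dec (Adjacent x y)
adjacent? x y = any? (λ a → adj? a x y)

update-induction : (P : Vec A m → Set) → (∀ y u v → P y → P (y [ u ]≔ v)) →
  ∀ {s t} → P s → P t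
update-induction {m = 0}     P step {[]}     {[]}     Ps = Ps
update-induction {m = suc m} P step {s₀ ∷ s} {t₀ ∷ t} Ps =
  update-induction (λ z → P (t₀ ∷ z)) (λ y u → step (t₀ ∷ y) (suc u)) (step (s₀ ∷ s) zero t₀ Ps)

-- Disagreement sets and maps of wreath form

disagreement : Vec (Fin n) m → Vec (Fin n) m → Subset m
disagreement x y = tabulate λ i → not (does (lookup x i ≟ lookup y i))

disagreement-sym : (x y : Vec (Fin n) m) → disagreement x y ≡ disagreement y x
disagreement-sym x y = tabulate-cong λ i →
  cong not (does-⇔ (mk⇔ sym sym) (lookup x i ≟ lookup y i) (lookup y i ≟ lookup x i))

disagreement-nonempty : {x y : Vec (Fin n) m} → x ≢ y → Nonempty (disagreement x y)
disagreement-nonempty {x = x} {y} x≢y with any? (λ i → ¬? (lookup x i ≟ lookup y i))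
... | yes (i , xᵢ≢yᵢ) =
  i , lookup⇒[]= i _
        (trans (lookup∘tabulate _ i) (cong not (dec-false (lookup x i ≟ lookup y i) xᵢ≢yᵢ)))
... | no ∄ = ⊥-elim (x≢y (lookup-ext λ i →
  decidable-stable (lookup x i ≟ lookup y i) λ xᵢ≢yᵢ → ∄ (i , xᵢ≢yᵢ)))

record WreathForm (φ : Perm (Vec (Fin n) m)) (β : Perm (Fin m))
                  (α : Fin m → Perm (Fin n)) : Set where
  constructor wreathForm
  field
    act : ∀ f → to φ f ≡ tabulate λ w → to (α w) (lookup f (to β w))

wreath : Perm (Fin m) → (Fin m → Perm (Fin n)) → Perm (Vec (Fin n) m)
wreath {m = m} {n = n} β α = mk↔ₛ′ act unact act∘unact unact∘act
  where
  act unact : Vec (Fin n) m → Vec (Fin n) m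
  act   f = tabulate λ w → to (α w) (lookup f (to β w))
  unact g = tabulate λ u → from (α (from β u)) (lookup g (from β u))

  act∘unact : ∀ g → act (unact g) ≡ g
  act∘unact g = lookup-ext λ w → begin
    lookup (act (unact g)) w
      ≡⟨ lookup∘tabulate _ w ⟩
    to (α w) (lookup (unact g) (to β w))
      ≡⟨ cong (to (α w)) (lookup∘tabulate _ (to β w)) ⟩
    to (α w) (from (α (from β (to β w))) (lookup g (from β (to β w))))
      ≡⟨ cong (λ u → to (α w) (from (α u) (lookup g u))) (strictlyInverseʳ β w) ⟩
    to (α w) (from (α w) (lookup g w))
      ≡⟨ strictlyInverseˡ (α w) _ ⟩
    lookup g w ∎

  unact∘act : ∀ f → unact (act f) ≡ f
  unact∘act f = lookup-ext λ u → begin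
    lookup (unact (act f)) u
      ≡⟨ lookup∘tabulate _ u ⟩
    from (α (from β u)) (lookup (act f) (from β u))
      ≡⟨ cong (from (α (from β u))) (lookup∘tabulate _ (from β u)) ⟩
    from (α (from β u)) (to (α (from β u)) (lookup f (to β (from β u))))
      ≡⟨ strictlyInverseʳ (α (from β u)) _ ⟩
    lookup f (to β (from β u))
      ≡⟨ cong (lookup f) (strictlyInverseˡ β u) ⟩
    lookup f u ∎

wreath-form : (β : Perm (Fin m)) (α : Fin m → Perm (Fin n)) → WreathForm (wreath β α) β α
wreath-form β α = wreathForm λ _ → refl

module _ {φ : Perm (Vec (Fin n) m)} {β : Perm (Fin m)} {α : Fin m → Perm (Fin n)}
         (form : WreathForm φ β α) where

  wreathForm-lookup : ∀ f w → lookup (to φ f) w ≡ to (α w) (lookup f (to β w))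
  wreathForm-lookup f w =
    trans (cong (λ g → lookup g w) (WreathForm.act form f)) (lookup∘tabulate _ w)

  wreathForm-agree : ∀ x y w →
    lookup (to φ x) w ≡ lookup (to φ y) w ⇔ lookup x (to β w) ≡ lookup y (to β w)
  wreathForm-agree x y w = mk⇔
    (λ e → perm-injective (α w)
             (trans (sym (wreathForm-lookup x w)) (trans e (wreathForm-lookup y w))))
    (λ e → trans (wreathForm-lookup x w) (trans (cong (to (α w)) e) (sym (wreathForm-lookup y w))))

  wreathForm-disagreement : ∀ x y →
    disagreement (to φ x) (to φ y) ≡ image (↔-sym β) (disagreement x y)
  wreathForm-disagreement x y = lookup-ext λ w → begin
    lookup (disagreement (to φ x) (to φ y)) w
      ≡⟨ lookup∘tabulate _ w ⟩
    not (does (lookup (to φ x) w ≟ lookup (to φ y) w))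
      ≡⟨ cong not (does-⇔ (wreathForm-agree x y w) (lookup (to φ x) w ≟ lookup (to φ y) w)
                                                   (lookup x (to β w) ≟ lookup y (to β w))) ⟩
    not (does (lookup x (to β w) ≟ lookup y (to β w)))
      ≡⟨ sym (lookup∘tabulate _ (to β w)) ⟩
    lookup (disagreement x y) (to β w)
      ≡⟨ sym (lookup∘tabulate _ w) ⟩
    lookup (image (↔-sym β) (disagreement x y)) w ∎

  wreathForm-adj : ∀ {a x y} → Adj a x y → Adj (from β a) (to φ x) (to φ y)
  wreathForm-adj {a} {x} {y} xy = mkAdj
    (λ e → differs xy (subst (λ i → lookup x i ≡ lookup y i) (strictlyInverseˡ β a)
                            (Equivalence.to (wreathForm-agree x y (from β a)) e)))
    (λ w w≢ → Equivalence.from (wreathForm-agree x y w)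
       (agrees xy (to β w) (λ e → w≢ (trans (sym (strictlyInverseʳ β w)) (cong (from β) e)))))

  wreathForm-adj⁻¹ : ∀ {b x y} → Adj b (to φ x) (to φ y) → Adj (to β b) x y
  wreathForm-adj⁻¹ {b} {x} {y} φxy = mkAdj
    (differs φxy ∘ Equivalence.from (wreathForm-agree x y b))
    (λ i i≢ → subst (λ j → lookup x j ≡ lookup y j) (strictlyInverseˡ β i)
       (Equivalence.to (wreathForm-agree x y (from β i))
         (agrees φxy (from β i) (λ e → i≢ (trans (sym (strictlyInverseˡ β i)) (cong (to β) e))))))

  wreathForm-preservesAdjacency : PreservesAdjacency φ
  wreathForm-preservesAdjacency x y = mk⇔
    (λ (a , xy) → from β a , wreathForm-adj xy)
    (λ (b , φxy) → to β b , wreathForm-adj⁻¹ φxy)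

origin : Vec (Fin (suc n)) m
origin = tabulate (const zero)

wreathForm-coordinates-unique : {φ : Perm (Vec (Fin (2 + n)) m)} {β β′ : Perm (Fin m)}
  {α α′ : Fin m → Perm (Fin (2 + n))} →
  WreathForm φ β α → WreathForm φ β′ α′ → ∀ w → to β′ w ≡ to β w
wreathForm-coordinates-unique {φ = φ} {β} {β′} {α} {α′} form form′ w =
  decidable-stable (to β′ w ≟ to β w) λ β′w≢βw →
    0≢1+n (perm-injective (α w) (sym (clash β′w≢βw)))
  where
  f = origin [ to β w ]≔ suc zero
  clash : to β′ w ≢ to β w → to (α w) (suc zero) ≡ to (α w) zero
  clash β′w≢βw = begin
    to (α w) (suc zero)                 ≡⟨ cong (to (α w)) (sym (lookup∘update (to β w) origin _)) ⟩
    to (α w) (lookup f (to β w))        ≡⟨ sym (wreathForm-lookup form f w) ⟩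
    lookup (to φ f) w                   ≡⟨ wreathForm-lookup form′ f w ⟩
    to (α′ w) (lookup f (to β′ w))      ≡⟨ cong (to (α′ w)) (lookup∘update′ β′w≢βw origin _) ⟩
    to (α′ w) (lookup origin (to β′ w)) ≡⟨ sym (wreathForm-lookup form′ origin w) ⟩
    lookup (to φ origin) w              ≡⟨ wreathForm-lookup form origin w ⟩
    to (α w) (lookup origin (to β w))   ≡⟨ cong (to (α w)) (lookup∘tabulate (const zero) (to β w)) ⟩
    to (α w) zero                       ∎

-- Automorphisms of the Hamming graph

preservesAdjacency-inverse : {φ : Perm (Vec A m)} →
  PreservesAdjacency φ → PreservesAdjacency (↔-sym φ)
preservesAdjacency-inverse {φ = φ} φ-adj x y =
  ⇔-sym (subst₂ (λ x′ y′ → Adjacent (from φ x) (from φ y) ⇔ Adjacent x′ y′)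
                (strictlyInverseˡ φ x) (strictlyInverseˡ φ y) (φ-adj (from φ x) (from φ y)))

module HammingAutomorphism {n m : ℕ} (φ : Perm (Vec (Fin (2 + n)) m))
                           (φ-adj : PreservesAdjacency φ) where

  image-adjacent : ∀ {a x y} → Adj a x y → Adjacent (to φ x) (to φ y)
  image-adjacent xy = Equivalence.to (φ-adj _ _) (_ , xy)

  image-apart : ∀ {x y} → Apart x y → Apart (to φ x) (to φ y)
  image-apart (x≢y , x≁y) = x≢y ∘ perm-injective φ , x≁y ∘ Equivalence.from (φ-adj _ _)

  direction : Vec (Fin (2 + n)) m → Fin m → Fin m
  direction x u = proj₁ (image-adjacent (update-adj x u (other-≢ (lookup x u))))

  direction-adj : ∀ x u {v} → v ≢ lookup x u →
    Adj (direction x u) (to φ x) (to φ (x [ u ]≔ v))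
  direction-adj x u {v} v≢xᵤ with v ≟ other (lookup x u)
  ... | yes refl = proj₂ (image-adjacent (update-adj x u (other-≢ (lookup x u))))
  ... | no v≢o   = subst (λ a → Adj a (to φ x) (to φ (x [ u ]≔ v))) (sym collinear)
                         (proj₂ towards-v)
    where
    towards-v = image-adjacent (update-adj x u v≢xᵤ)
    other-to-v : Adj u (x [ u ]≔ other (lookup x u)) (x [ u ]≔ v)
    other-to-v = subst (Adj u _) ([]≔-idempotent x u)
      (update-adj (x [ u ]≔ other (lookup x u)) u (λ e → v≢o (trans e (lookup∘update u x _))))
    collinear : direction x u ≡ proj₁ towards-v
    collinear = triangle-direction (proj₂ (image-adjacent (update-adj x u (other-≢ _))))
                                   (proj₂ towards-v) (image-adjacent other-to-v)

  direction-update-elsewhere : ∀ x {u w q} → q ≢ lookup x u → u ≢ w →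
    direction (x [ u ]≔ q) w ≡ direction x w
  direction-update-elsewhere x {u} {w} {q} q≢xᵤ u≢w =
    square-direction (direction-adj x w (other-≢ _)) (direction-adj x u q≢xᵤ)
                     (direction-adj g₂ w (λ e → other-≢ _ (trans e g₂w))) side₄
                     (image-apart (two-differences⇒apart u≢w g₁g₂-differ-u g₁g₂-differ-w))
                     (image-apart (two-differences⇒apart u≢w xg₃-differ-u xg₃-differ-w))
    where
    p = other (lookup x w)
    g₁ = x [ w ]≔ p
    g₂ = x [ u ]≔ q
    g₃ = g₂ [ w ]≔ p
    g₁u : lookup g₁ u ≡ lookup x u
    g₁u = lookup∘update′ u≢w x p
    g₂w : lookup g₂ w ≡ lookup x w
    g₂w = lookup∘update′ (u≢w ∘ sym) x q
    side₄ : Adj (direction g₁ u) (to φ g₁) (to φ g₃)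
    side₄ = subst (λ z → Adj (direction g₁ u) (to φ g₁) (to φ z))
                  ([]≔-commutes x w u (u≢w ∘ sym))
                  (direction-adj g₁ u (λ e → q≢xᵤ (trans e g₁u)))
    g₁g₂-differ-u : lookup g₁ u ≢ lookup g₂ u
    g₁g₂-differ-u e = q≢xᵤ (sym (trans (sym g₁u) (trans e (lookup∘update u x q))))
    g₁g₂-differ-w : lookup g₁ w ≢ lookup g₂ w
    g₁g₂-differ-w e = other-≢ _ (trans (sym (lookup∘update w x p)) (trans e g₂w))
    xg₃-differ-u : lookup x u ≢ lookup g₃ u
    xg₃-differ-u e = q≢xᵤ (sym (trans e (trans (lookup∘update′ u≢w g₂ p) (lookup∘update u x q))))
    xg₃-differ-w : lookup x w ≢ lookup g₃ w
    xg₃-differ-w e = other-≢ _ (sym (trans e (lookup∘update w g₂ p)))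

  direction-update : ∀ x u q w → direction (x [ u ]≔ q) w ≡ direction x w
  direction-update x u q w with q ≟ lookup x u | u ≟ w
  ... | yes refl | _        = cong (λ z → direction z w) ([]≔-lookup x u)
  ... | no q≢xᵤ  | no u≢w   = direction-update-elsewhere x q≢xᵤ u≢w
  ... | no q≢xᵤ  | yes refl = adj-unique back (adj-sym (direction-adj x u q≢xᵤ))
    where
    back : Adj (direction (x [ u ]≔ q) u) (to φ (x [ u ]≔ q)) (to φ x)
    back = subst (λ z → Adj (direction (x [ u ]≔ q) u) (to φ (x [ u ]≔ q)) (to φ z))
                 (trans ([]≔-idempotent x u) ([]≔-lookup x u))
                 (direction-adj (x [ u ]≔ q) u (λ e → q≢xᵤ (sym (trans e (lookup∘update u x q)))))

  axis : Fin m → Fin m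
  axis = direction origin

  direction-axis : ∀ x w → direction x w ≡ axis w
  direction-axis x w = update-induction (λ y → direction y w ≡ axis w)
    (λ y u q e → trans (direction-update y u q w) e) {t = x} refl

  axis-adj : ∀ x u {v} → v ≢ lookup x u → Adj (axis u) (to φ x) (to φ (x [ u ]≔ v))
  axis-adj x u v≢xᵤ = subst (λ a → Adj a _ _) (direction-axis x u) (direction-adj x u v≢xᵤ)

  coordinate : Fin m → Fin (2 + n) → Fin (2 + n)
  coordinate u v = lookup (to φ (origin [ u ]≔ v)) (axis u)

  module _ (axis-injective : Injective _≡_ _≡_ axis) where

    update-fixes-axis : ∀ y {j u} v → j ≢ u →
      lookup (to φ (y [ j ]≔ v)) (axis u) ≡ lookup (to φ y) (axis u)
    update-fixes-axis y {j} {u} v j≢u with v ≟ lookup y j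
    ... | yes refl = cong (λ z → lookup (to φ z) (axis u)) ([]≔-lookup y j)
    ... | no v≢yⱼ  = sym (agrees (axis-adj y j v≢yⱼ) (axis u) (j≢u ∘ sym ∘ axis-injective))

    lookup-image-update : ∀ y u v → lookup (to φ (y [ u ]≔ v)) (axis u) ≡ coordinate u v
    lookup-image-update y u v = update-induction P step {s = origin} {t = y} refl
      where
      P : Vec (Fin (2 + n)) m → Set
      P z = lookup (to φ (z [ u ]≔ v)) (axis u) ≡ coordinate u v
      step : ∀ z j t → P z → P (z [ j ]≔ t)
      step z j t e with j ≟ u
      ... | yes refl = trans (cong (λ g → lookup (to φ g) (axis j)) ([]≔-idempotent z j)) e
      ... | no j≢u   = trans (cong (λ g → lookup (to φ g) (axis u)) ([]≔-commutes z j u j≢u))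
                             (trans (update-fixes-axis (z [ u ]≔ v) t j≢u) e)

    lookup-image : ∀ x u → lookup (to φ x) (axis u) ≡ coordinate u (lookup x u)
    lookup-image x u = trans (cong (λ g → lookup (to φ g) (axis u)) (sym ([]≔-lookup x u)))
                             (lookup-image-update x u (lookup x u))

module _ (φ ψ : Perm (Vec (Fin (2 + n)) m)) (φ-adj : PreservesAdjacency φ)
         (ψ-adj : PreservesAdjacency ψ) (ψ∘φ≡id : ∀ x → to ψ (to φ x) ≡ x) where

  private
    module Hφ = HammingAutomorphism φ φ-adj
    module Hψ = HammingAutomorphism ψ ψ-adj

  axis-cancel : ∀ w → Hψ.axis (Hφ.axis w) ≡ w
  axis-cancel w = adj-unique (subst₂ (Adj _) (ψ∘φ≡id origin) ψφy≡y ψφ-edge)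
                             (update-adj origin w (other-≢ _))
    where
    y = origin [ w ]≔ other (lookup origin w)
    φ-edge = Hφ.axis-adj origin w (other-≢ _)
    ψφ-edge = Hψ.axis-adj (to φ origin) (Hφ.axis w) (differs φ-edge ∘ sym)
    ψφy≡y : to ψ (to φ origin [ Hφ.axis w ]≔ lookup (to φ y) (Hφ.axis w)) ≡ y
    ψφy≡y = trans (cong (to ψ) (adj⇒update φ-edge)) (ψ∘φ≡id y)

  coordinate-cancel : Injective _≡_ _≡_ Hψ.axis →
    ∀ u v → Hψ.coordinate (Hφ.axis u) (Hφ.coordinate u v) ≡ v
  coordinate-cancel ψ-axis-injective u v = begin
    Hψ.coordinate (Hφ.axis u) (Hφ.coordinate u v)
      ≡⟨ sym (Hψ.lookup-image ψ-axis-injective (to φ x) (Hφ.axis u)) ⟩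
    lookup (to ψ (to φ x)) (Hψ.axis (Hφ.axis u))
      ≡⟨ cong₂ lookup (ψ∘φ≡id x) (axis-cancel u) ⟩
    lookup x u
      ≡⟨ lookup∘update u origin v ⟩
    v ∎
    where
    x = origin [ u ]≔ v

hamming-automorphism : (φ : Perm (Vec (Fin (2 + n)) m)) → PreservesAdjacency φ →
  Σ (Perm (Fin m)) λ β → ∃ λ α → WreathForm φ β α
hamming-automorphism {n = n} {m = m} φ φ-adj = β , α , form
  where
  ψ-adj : PreservesAdjacency (↔-sym φ)
  ψ-adj = preservesAdjacency-inverse {φ = φ} φ-adj
  module Hφ = HammingAutomorphism φ φ-adj
  module Hψ = HammingAutomorphism (↔-sym φ) ψ-adj

  axis-cancelφ : ∀ w → Hψ.axis (Hφ.axis w) ≡ w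
  axis-cancelφ = axis-cancel φ (↔-sym φ) φ-adj ψ-adj (strictlyInverseʳ φ)
  axis-cancelψ : ∀ w → Hφ.axis (Hψ.axis w) ≡ w
  axis-cancelψ = axis-cancel (↔-sym φ) φ ψ-adj φ-adj (strictlyInverseˡ φ)

  β : Perm (Fin m)
  β = mk↔ₛ′ Hψ.axis Hφ.axis axis-cancelφ axis-cancelψ

  α : Fin m → Perm (Fin (2 + n))
  α w = mk↔ₛ′ (Hφ.coordinate (Hψ.axis w)) (Hψ.coordinate w)
    (coordinate-cancel (↔-sym φ) φ ψ-adj φ-adj (strictlyInverseˡ φ)
                       (perm-injective (↔-sym β)) w)
    (λ v → subst (λ a → Hψ.coordinate a (Hφ.coordinate (Hψ.axis w) v) ≡ v) (axis-cancelψ w)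
                 (coordinate-cancel φ (↔-sym φ) φ-adj ψ-adj (strictlyInverseʳ φ)
                                    (perm-injective β) (Hψ.axis w) v))

  form : WreathForm φ β α
  form = wreathForm λ f → lookup-ext λ w → begin
    lookup (to φ f) w
      ≡⟨ cong (lookup (to φ f)) (sym (axis-cancelψ w)) ⟩
    lookup (to φ f) (Hφ.axis (Hψ.axis w))
      ≡⟨ Hφ.lookup-image (perm-injective (↔-sym β)) f (Hψ.axis w) ⟩
    Hφ.coordinate (Hψ.axis w) (lookup f (Hψ.axis w))
      ≡⟨ sym (lookup∘tabulate _ w) ⟩
    lookup (tabulate λ w → to (α w) (lookup f (to β w))) w ∎

-- Graph and hypergraph colourings

indicator : Subset m → Vec (Fin (2 + n)) m
indicator S = tabulate (bit ∘ lookup S)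

disagreement-origin-indicator : (S : Subset m) → disagreement {2 + n} origin (indicator S) ≡ S
disagreement-origin-indicator S = lookup-ext λ i →
  trans (lookup∘tabulate _ i)
        (trans (cong₂ (λ p q → not (does (p ≟ q))) (lookup∘tabulate _ i) (lookup∘tabulate _ i))
               (not-does-zero≟bit (lookup S i)))
  where
  not-does-zero≟bit : ∀ b → not (does (zero ≟ bit {n} b)) ≡ b
  not-does-zero≟bit false = refl
  not-does-zero≟bit true  = refl

origin≢indicator : {S : Subset m} → Nonempty S → origin ≢ indicator {n = n} S
origin≢indicator {S = S} (i , i∈S) origin≡1S = 0≢1+n (begin
  zero                    ≡⟨ sym (lookup∘tabulate _ i) ⟩
  lookup origin i         ≡⟨ cong (λ z → lookup z i) origin≡1S ⟩
  lookup (indicator S) i  ≡⟨ lookup∘tabulate _ i ⟩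
  bit (lookup S i)        ≡⟨ cong bit ([]=⇒lookup i∈S) ⟩
  suc zero                ∎)

relabel : Perm (Fin m) → Perm (Vec (Fin n) m)
relabel σ = wreath (↔-sym σ) (λ _ → ↔-id _)

relabel-tabulate : (σ : Perm (Fin m)) (g : Fin m → Fin n) →
  to (relabel σ) (tabulate g) ≡ tabulate (g ∘ from σ)
relabel-tabulate σ g = tabulate-cong λ w → lookup∘tabulate g (from σ w)

relabel-form : (σ : Perm (Fin m)) → WreathForm (relabel {n = n} σ) (↔-sym σ) (λ _ → ↔-id _)
relabel-form σ = wreath-form (↔-sym σ) (λ _ → ↔-id _)

module _ (B : Perm (Fin m) → Set) (B-group : IsPermGroup B) where

  open IsPermGroup B-group

  wreath∈ : ∀ {β} (α : Fin m → Perm (Fin n)) → B β → WreathSym n m B (wreath β α)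
  wreath∈ {β = β} α β∈B = β , β∈B , α , λ _ → refl

  InBGR⇒InGR-wreath : InBGR B → InGR (WreathSym (2 + n) m B)
  InBGR⇒InGR-wreath {n} (c , c-aut) = Γ , λ φ → mk⇔ (wreath-aut φ) (aut-wreath φ)
    where
    Γ : ColoredGraph (Vec (Fin (2 + n)) m)
    Γ = record
      { colour    = λ x y → tag (does (adjacent? x y)) (c (disagreement x y))
      ; symmetric = λ x y → cong₂ tag (does-⇔ adjacent-sym (adjacent? x y) (adjacent? y x))
                                      (cong c (disagreement-sym x y))
      }

    wreath-aut : ∀ φ → WreathSym (2 + n) m B φ → IsGraphAut Γ φ
    wreath-aut φ (β , β∈B , α , act) x y x≢y = cong₂ tag
      (does-⇔ (⇔-sym (wreathForm-preservesAdjacency form x y))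
              (adjacent? (to φ x) (to φ y)) (adjacent? x y))
      (trans (cong c (wreathForm-disagreement form x y))
             (Equivalence.to (c-aut (↔-sym β)) (inv∈ β∈B) _ (disagreement-nonempty x≢y)))
      where
      form : WreathForm φ β α
      form = wreathForm act

    aut-wreath : ∀ φ → IsGraphAut Γ φ → WreathSym (2 + n) m B φ
    aut-wreath φ φ-aut = β , β∈B , α , WreathForm.act form
      where
      φ-aut-parts : ∀ x y → x ≢ y →
        does (adjacent? (to φ x) (to φ y)) ≡ does (adjacent? x y) ×
        c (disagreement (to φ x) (to φ y)) ≡ c (disagreement x y)
      φ-aut-parts x y x≢y = tag-injective
        {b = does (adjacent? (to φ x) (to φ y))} {b′ = does (adjacent? x y)}
        {c = c (disagreement (to φ x) (to φ y))} {c′ = c (disagreement x y)} (φ-aut x y x≢y)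

      φ-adj : PreservesAdjacency φ
      φ-adj x y with ≡-dec _≟_ x y
      ... | yes refl = mk⇔ (⊥-elim ∘ adjacent-irrefl) (⊥-elim ∘ adjacent-irrefl)
      ... | no x≢y   = ⇔-sym (does-≡⇒⇔ (adjacent? (to φ x) (to φ y)) (adjacent? x y)
                                         (proj₁ (φ-aut-parts x y x≢y)))
      decomposition = hamming-automorphism φ φ-adj
      β = proj₁ decomposition
      α = proj₁ (proj₂ decomposition)
      form = proj₂ (proj₂ decomposition)

      c-invariant : IsHyperAut c (↔-sym β)
      c-invariant S S≠∅ = begin
        c (image (↔-sym β) S)
          ≡⟨ cong (c ∘ image (↔-sym β)) (sym (disagreement-origin-indicator {n = n} S)) ⟩
        c (image (↔-sym β) (disagreement origin (indicator S)))
          ≡⟨ cong c (sym (wreathForm-disagreement form origin (indicator S))) ⟩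
        c (disagreement (to φ origin) (to φ (indicator S)))
          ≡⟨ proj₂ (φ-aut-parts origin (indicator S) (origin≢indicator S≠∅)) ⟩
        c (disagreement origin (indicator {n = n} S))
          ≡⟨ cong c (disagreement-origin-indicator S) ⟩
        c S ∎

      β∈B : B β
      β∈B = respects (λ _ → refl) (inv∈ (Equivalence.from (c-aut (↔-sym β)) c-invariant))

  InGR-wreath⇒InBGR : InGR (WreathSym (2 + n) m B) → InBGR B
  InGR-wreath⇒InBGR {n} (Γ , Γ-aut) = c , λ σ → mk⇔ (hyperAut σ) (member σ)
    where
    colour = ColoredGraph.colour Γ
    c : Subset m → ℕ
    c S = colour origin (indicator S)

    wreath-aut : ∀ φ → WreathSym (2 + n) m B φ → IsGraphAut Γ φ
    wreath-aut φ = Equivalence.to (Γ-aut φ)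

    hyperAut : ∀ σ → B σ → IsHyperAut c σ
    hyperAut σ σ∈B S S≠∅ = trans
      (cong₂ colour (sym (relabel-tabulate σ (const zero)))
                    (trans (tabulate-cong λ w → cong bit (lookup∘tabulate _ w))
                           (sym (relabel-tabulate σ (bit ∘ lookup S)))))
      (wreath-aut (relabel σ) (wreath∈ (λ _ → ↔-id _) (inv∈ σ∈B))
                  origin (indicator S) (origin≢indicator S≠∅))

    -- A map of wreath form sends (origin, indicator of the disagreement set) to (x, y).
    colour-disagreement : ∀ {x y} → x ≢ y → colour x y ≡ c (disagreement x y)
    colour-disagreement {x} {y} x≢y = trans
      (cong₂ colour (sym ψ-origin) (sym ψ-indicator))
      (wreath-aut ψ (wreath∈ π id∈) origin (indicator (disagreement x y))
                  (origin≢indicator (disagreement-nonempty x≢y)))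
      where
      π : Fin m → Perm (Fin (2 + n))
      π w = proj₁ (pair-permutation (lookup x w) (lookup y w))
      ψ = wreath (↔-id _) π
      ψ-origin : to ψ origin ≡ x
      ψ-origin = lookup-ext λ w → trans (lookup∘tabulate _ w)
        (trans (cong (to (π w)) (lookup∘tabulate _ w))
               (proj₁ (proj₂ (pair-permutation (lookup x w) (lookup y w)))))
      ψ-indicator : to ψ (indicator (disagreement x y)) ≡ y
      ψ-indicator = lookup-ext λ w → trans (lookup∘tabulate _ w)
        (trans (cong (to (π w)) (trans (lookup∘tabulate _ w) (cong bit (lookup∘tabulate _ w))))
               (proj₂ (proj₂ (pair-permutation (lookup x w) (lookup y w)))))

    relabel-aut : ∀ σ → IsHyperAut c σ → IsGraphAut Γ (relabel σ)
    relabel-aut σ c-aut x y x≢y = begin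
      colour (to (relabel σ) x) (to (relabel σ) y)
        ≡⟨ colour-disagreement (x≢y ∘ perm-injective (relabel σ)) ⟩
      c (disagreement (to (relabel σ) x) (to (relabel σ) y))
        ≡⟨ cong c (wreathForm-disagreement (relabel-form σ) x y) ⟩
      c (image σ (disagreement x y))
        ≡⟨ c-aut _ (disagreement-nonempty x≢y) ⟩
      c (disagreement x y)
        ≡⟨ sym (colour-disagreement x≢y) ⟩
      colour x y ∎

    member : ∀ σ → IsHyperAut c σ → B σ
    member σ c-aut with Equivalence.from (Γ-aut (relabel σ)) (relabel-aut σ c-aut)
    ... | β , β∈B , α , act = respects β⁻¹≈σ (inv∈ β∈B)
      where
      β≗σ⁻¹ : ∀ w → to β w ≡ from σ w
      β≗σ⁻¹ = wreathForm-coordinates-unique (relabel-form σ) (wreathForm {β = β} {α = α} act)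
      β⁻¹≈σ : ↔-sym β ≈ₚ σ
      β⁻¹≈σ x = trans (cong (from β) (sym (trans (β≗σ⁻¹ (to σ x)) (strictlyInverseʳ σ x))))
                      (strictlyInverseʳ β (to σ x))

proposition3p9 : ∀ (n m : ℕ) → 2 ≤ n → (B : Perm (Fin m) → Set) → IsPermGroup B →
    InGR (WreathSym n m B) ⇔ InBGR B
proposition3p9 (suc (suc n)) m (s≤s (s≤s _)) B B-group =
  mk⇔ (InGR-wreath⇒InBGR B B-group) (InBGR⇒InGR-wreath B B-group)
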